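{- Every finite graph $G$ without isolated vertices has a $\gamma_b$-broadcast $f$ such that, for every vertex $v$ with $f(v)>0$, the external $f$-private boundary $\operatorname{EPB}_f(v)$ is nonempty.
   Context: Let $G=(V,E)$ be a finite connected graph with at least two vertices, and let $e(v)$ denote the eccentricity of $v$. A broadcast on $G$ is a function $f:V\to\{0,1,\dots,\operatorname{diam}(G)\}$ with $f(v)\le e(v)$ for all $v$. If $G$ is disconnected, a broadcast on $G$ is a union of broadcasts on its components. The cost of $f$ is $\sigma(f)=\sum_v f(v)$. Let $V_f^+=\{v:f(v)>0\}$. A vertex $u$ is dominated by $f$ if $d(u,v)\le f(v)$ for some $v\in V_f^+$. The broadcast $f$ is dominating if every vertex is dominated. Let $\gamma_b(G)$ be the minimum cost of a dominating broadcast of $G$. A $\gamma_b$-broadcast is a dominating broadcast of cost $\gamma_b(G)$. For $v\in V_f^+$, let $N_f[v]=\{u:d(u,v)\le f(v)\}$. The $f$-private boundary $\operatorname{PB}_f(v)$ is the set of $u\in N_f[v]$ that are not dominated by the broadcast obtained from $f$ by replacing $f(v)$ with $f(v)-1$, other values unchanged. The external $f$-private boundary is $\operatorname{EPB}_f(v)=\operatorname{PB}_f(v)-\{v\}$. -}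

module Defs where

open import Data.Nat using (ℕ; zero; suc; _+_; _≤_; _<_; pred)
open import Data.Fin using (Fin; zero; suc; _≟_)
open import Data.Bool using (Bool; true; false; if_then_else_)
open import Data.Product using (Σ; ∃; ∃-syntax; _×_; _,_)
open import Relation.Nullary using (¬_; does)
open import Relation.Binary.PropositionalEquality using (_≡_)

record Graph (n : ℕ) : Set where
  field
    adj       : Fin n → Fin n → Bool
    adj-sym   : ∀ u v → adj u v ≡ adj v u
    adj-irref : ∀ v → adj v v ≡ false
open Graph public

data Walk {n : ℕ} (G : Graph n) : ℕ → Fin n → Fin n → Set where
  nil  : ∀ {u} → Walk G 0 u u
  cons : ∀ {k u w v} → adj G u w ≡ true → Walk G k w v → Walk G (suc k) u v

-- d(u,v) ≤ k  (distance is the minimum walk length; ∞ between components)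
DistLe : ∀ {n} → Graph n → ℕ → Fin n → Fin n → Set
DistLe G k u v = ∃[ m ] (m ≤ k × Walk G m u v)

Reachable : ∀ {n} → Graph n → Fin n → Fin n → Set
Reachable G u v = ∃[ m ] Walk G m u v

-- k ≤ e(v), eccentricity taken within the component of v:
-- some u in the component of v has d(v,u) ≥ k.
EccGe : ∀ {n} → Graph n → Fin n → ℕ → Set
EccGe G v k = ∃[ u ] (Reachable G v u × (∀ m → Walk G m v u → k ≤ m))

NoIsolated : ∀ {n} → Graph n → Set
NoIsolated {n} G = ∀ (v : Fin n) → ∃[ u ] (adj G v u ≡ true)

-- Broadcast (union of broadcasts on the components): f(v) ≤ e(v) for all v.
IsBroadcast : ∀ {n} → Graph n → (Fin n → ℕ) → Set
IsBroadcast G f = ∀ v → EccGe G v (f v)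

cost : ∀ {n} → (Fin n → ℕ) → ℕ
cost {zero}  f = 0
cost {suc n} f = f zero + cost (λ i → f (suc i))

Dominated : ∀ {n} → Graph n → (Fin n → ℕ) → Fin n → Set
Dominated G f u = ∃[ v ] (0 < f v × DistLe G (f v) u v)

IsDominating : ∀ {n} → Graph n → (Fin n → ℕ) → Set
IsDominating G f = ∀ u → Dominated G f u

DominatingBroadcast : ∀ {n} → Graph n → (Fin n → ℕ) → Set
DominatingBroadcast G f = IsBroadcast G f × IsDominating G f

IsGammaBBroadcast : ∀ {n} → Graph n → (Fin n → ℕ) → Set
IsGammaBBroadcast {n} G f =
  DominatingBroadcast G f ×
  (∀ (g : Fin n → ℕ) → DominatingBroadcast G g → cost f ≤ cost g)

decAt : ∀ {n} → (Fin n → ℕ) → Fin n → Fin n → ℕ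
decAt f v w = if does (w ≟ v) then pred (f v) else f w

InPB : ∀ {n} → Graph n → (Fin n → ℕ) → Fin n → Fin n → Set
InPB G f v u = DistLe G (f v) u v × ¬ Dominated G (decAt f v) u

EPBNonempty : ∀ {n} → Graph n → (Fin n → ℕ) → Fin n → Set
EPBNonempty G f v = ∃[ u ] (¬ (u ≡ v) × InPB G f v u)

-- Among the γ_b-broadcasts choose one, f, with the fewest
-- broadcasting vertices. Minimality of the cost makes every PB_f(v) nonempty,
-- since otherwise lowering f(v) by one would still dominate. If EPB_f(v) were
-- empty, then PB_f(v) = {v}, which forces f(v) = 1. A neighbour u of v is then
-- dominated by some w ≠ v whose ball does not contain v; setting f(v) := 0 and
-- f(w) := f(w) + 1 gives a dominating broadcast of no larger cost with fewer
-- broadcasting vertices, a contradiction. The minima exist constructively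
-- because distance bounds, eccentricity bounds and domination are decidable,
-- and a broadcast of cost at most k takes values at most k, so the candidates
-- can be searched exhaustively.

module Submission where

open import Defs
open import Data.Nat using (ℕ; zero; suc; _+_; _≤_; _<_; _⊓_; pred; z≤n; s≤s; _≤?_; _<?_)
open import Data.Nat.Properties hiding (_≟_)
open import Data.Nat.Induction using (<-rec; <-wellFounded)
open import Data.Fin as Fin using (Fin; zero; suc; toℕ; fromℕ<; _≟_)
open import Data.Fin.Properties using (any?; all?; ¬∀⟶∃¬; pigeonhole; toℕ<n; toℕ-fromℕ<)
open import Data.Bool using (true; if_then_else_)
import Data.Bool.Properties as Bool
open import Data.Product using (∃-syntax; _×_; _,_; proj₁; proj₂)
open import Data.Sum using (_⊎_; inj₁; inj₂)
open import Data.Empty using (⊥-elim)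
open import Data.Vec.Functional using (_∷_)
open import Function using (_∘_; case_of_)
open import Induction.WellFounded using (module All)
import Relation.Binary.Construct.On as On
open import Relation.Nullary using (¬_; Dec; yes; no; does)
open import Relation.Nullary.Decidable
  using (map′; _×-dec_; _⊎-dec_; ¬?; dec-true; dec-false; decidable-stable)
open import Relation.Unary using (Decidable)
open import Relation.Binary.PropositionalEquality

pred-< : ∀ {k} → 0 < k → pred k < k
pred-< (s≤s _) = ≤-refl

1⊓-positive : ∀ {k} → 0 < k → 1 ⊓ k ≡ 1
1⊓-positive (s≤s _) = refl

least : ∀ {P : ℕ → Set} → Decidable P → ∀ k → P k → ∃[ m ] (P m × ∀ j → P j → m ≤ j)
least {P} P? = <-rec _ step
  where
    step : ∀ k → (∀ {j} → j < k → P j → ∃[ m ] (P m × ∀ i → P i → m ≤ i)) →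
           P k → ∃[ m ] (P m × ∀ i → P i → m ≤ i)
    step k smaller pk with any? (λ (j : Fin k) → P? (toℕ j))
    ... | yes (j , pj) = smaller (toℕ<n j) pj
    ... | no none      = k , pk , λ j pj →
      ≮⇒≥ (λ j<k → none (fromℕ< j<k , subst P (sym (toℕ-fromℕ< j<k)) pj))

∃-bounded? : ∀ m B {P : (Fin m → ℕ) → Set} → (∀ {f g} → f ≗ g → P f → P g) → Decidable P →
             Dec (∃[ f ] ((∀ x → f x ≤ B) × P f))
∃-bounded? zero B resp P? with P? (λ ())
... | yes p = yes ((λ ()) , (λ ()) , p)
... | no ¬p = no λ (f , _ , p) → ¬p (resp (λ ()) p)
∃-bounded? (suc m) B {P} resp P? =
  map′ to from (any? λ (a : Fin (suc B)) → ∃-bounded? m B (resp ∘ ∷-cong) (P? ∘ (toℕ a ∷_)))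
  where
    ∷-cong : ∀ {a} {f g : Fin m → ℕ} → f ≗ g → (a ∷ f) ≗ (a ∷ g)
    ∷-cong f≗g zero    = refl
    ∷-cong f≗g (suc x) = f≗g x
    to : ∃[ a ] ∃[ f ] ((∀ x → f x ≤ B) × P (toℕ a ∷ f)) → ∃[ f ] ((∀ x → f x ≤ B) × P f)
    to (a , f , f≤B , p) = toℕ a ∷ f , (λ { zero → ≤-pred (toℕ<n a) ; (suc x) → f≤B x }) , p
    from : ∃[ f ] ((∀ x → f x ≤ B) × P f) → ∃[ a ] ∃[ f ] ((∀ x → f x ≤ B) × P (toℕ a ∷ f))
    from (f , f≤B , p) = fromℕ< (s≤s (f≤B zero)) , f ∘ suc , f≤B ∘ suc ,
      resp (λ { zero → sym (toℕ-fromℕ< (s≤s (f≤B zero))) ; (suc x) → refl }) p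

update : ∀ {m} → (Fin m → ℕ) → Fin m → ℕ → Fin m → ℕ
update f v a x = if does (x ≟ v) then a else f x

update-same : ∀ {m} (f : Fin m → ℕ) v a → update f v a v ≡ a
update-same f v a rewrite dec-true (v ≟ v) refl = refl

update-other : ∀ {m} (f : Fin m → ℕ) {v x} a → x ≢ v → update f v a x ≡ f x
update-other f {v} {x} a x≢v rewrite dec-false (x ≟ v) x≢v = refl

-- decAt f v is, by definition, update f v (pred (f v)).
decAt-≤ : ∀ {m} (f : Fin m → ℕ) v x → decAt f v x ≤ f x
decAt-≤ f v x with x ≟ v
... | yes refl = pred[n]≤n
... | no _     = ≤-refl

cost-cong : ∀ {m} {f g : Fin m → ℕ} → f ≗ g → cost f ≡ cost g
cost-cong {zero}  f≗g = refl
cost-cong {suc m} f≗g = cong₂ _+_ (f≗g zero) (cost-cong (f≗g ∘ suc))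

≤-cost : ∀ {m} (f : Fin m → ℕ) v → f v ≤ cost f
≤-cost f zero    = m≤m+n (f zero) _
≤-cost f (suc v) = ≤-trans (≤-cost (f ∘ suc) v) (m≤n+m _ (f zero))

cost-update : ∀ {m} (f : Fin m → ℕ) v a → cost (update f v a) + f v ≡ cost f + a
cost-update {suc m} f zero a = begin
  a + cost (f ∘ suc) + f zero    ≡⟨ +-assoc a _ _ ⟩
  a + (cost (f ∘ suc) + f zero)  ≡⟨ cong (a +_) (+-comm _ (f zero)) ⟩
  a + (f zero + cost (f ∘ suc))  ≡⟨ +-comm a _ ⟩
  f zero + cost (f ∘ suc) + a    ∎
  where open ≡-Reasoning
cost-update {suc m} f (suc v) a = begin
  f zero + cost (update (f ∘ suc) v a) + f (suc v)    ≡⟨ +-assoc (f zero) _ _ ⟩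
  f zero + (cost (update (f ∘ suc) v a) + f (suc v))  ≡⟨ cong (f zero +_) (cost-update (f ∘ suc) v a) ⟩
  f zero + (cost (f ∘ suc) + a)                       ≡⟨ +-assoc (f zero) _ _ ⟨
  f zero + cost (f ∘ suc) + a                         ∎
  where open ≡-Reasoning

cost-update-< : ∀ {m} (f : Fin m → ℕ) v {a} → a < f v → cost (update f v a) < cost f
cost-update-< f v {a} a<fv = +-cancelʳ-< (f v) _ _ (begin-strict
  cost (update f v a) + f v  ≡⟨ cost-update f v a ⟩
  cost f + a                 <⟨ +-monoʳ-< (cost f) a<fv ⟩
  cost f + f v               ∎)
  where open ≤-Reasoning

module _ {n : ℕ} (G : Graph n) where

  adj⇒≢ : ∀ {u v} → adj G u v ≡ true → u ≢ v
  adj⇒≢ {u} e refl = case trans (sym e) (adj-irref G u) of λ ()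

  snoc : ∀ {m u v x} → Walk G m u v → adj G v x ≡ true → Walk G (suc m) u x
  snoc nil         e = cons e nil
  snoc (cons e′ w) e = cons e′ (snoc w e)

  reverse : ∀ {m u v} → Walk G m u v → Walk G m v u
  reverse nil        = nil
  reverse (cons e w) = snoc (reverse w) (trans (adj-sym G _ _) e)

  DistLe-zero : ∀ {u v} → DistLe G 0 u v → u ≡ v
  DistLe-zero (0 , z≤n , nil) = refl

  DistLe-weaken : ∀ {j k u v} → j ≤ k → DistLe G j u v → DistLe G k u v
  DistLe-weaken j≤k (m , m≤j , w) = m , ≤-trans m≤j j≤k , w

  DistLe-sym : ∀ {k u v} → DistLe G k u v → DistLe G k v u
  DistLe-sym (m , m≤k , w) = m , m≤k , reverse w

  DistLe-cons : ∀ {k u x v} → adj G u x ≡ true → DistLe G k x v → DistLe G (suc k) u v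
  DistLe-cons e (m , m≤k , w) = suc m , s≤s m≤k , cons e w

  DistLe⇒Reachable : ∀ {k u v} → DistLe G k u v → Reachable G u v
  DistLe⇒Reachable (m , _ , w) = m , w

  vertexAt : ∀ {m u v} → Walk G m u v → Fin (suc m) → Fin n
  vertexAt {u = u} _          zero    = u
  vertexAt         (cons _ w) (suc i) = vertexAt w i

  suffix : ∀ {m u v} (w : Walk G m u v) (j : Fin (suc m)) →
           ∃[ k ] (k + toℕ j ≡ m × Walk G k (vertexAt w j) v)
  suffix {m} w zero = m , +-identityʳ m , w
  suffix (cons _ w) (suc j) with suffix w j
  ... | k , k+j≡m , w′ = k , trans (+-suc k (toℕ j)) (cong suc k+j≡m) , w′

  shortcut : ∀ {m u v} (w : Walk G m u v) {i j} → i Fin.< j → vertexAt w i ≡ vertexAt w j →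
             ∃[ k ] (k < m × Walk G k u v)
  shortcut {v = v} w {zero} {j} 0<j eq with suffix w j
  ... | k , k+j≡m , w′ = k , subst (k <_) k+j≡m (m<m+n k 0<j) , subst (λ x → Walk G k x v) (sym eq) w′
  shortcut (cons e w) {suc i} {suc j} i<j eq with shortcut w (≤-pred i<j) eq
  ... | k , k<m , w′ = suc k , s≤s k<m , cons e w′

  walk⇒DistLe : ∀ {m u v} → Walk G m u v → DistLe G n u v
  walk⇒DistLe {m} = <-rec (λ m → ∀ {u v} → Walk G m u v → DistLe G n u v) shorten m
    where
      shorten : ∀ m → (∀ {k} → k < m → ∀ {u v} → Walk G k u v → DistLe G n u v) →
                ∀ {u v} → Walk G m u v → DistLe G n u v
      shorten m shorter w with m <? n
      ... | yes m<n = m , <⇒≤ m<n , w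
      ... | no m≮n with pigeonhole (s≤s (≮⇒≥ m≮n)) (vertexAt w)
      ... | i , j , i<j , eq with shortcut w i<j eq
      ... | k , k<m , w′ = shorter k<m w′

  distLe? : ∀ k u v → Dec (DistLe G k u v)
  distLe? zero    u v = map′ (λ { refl → 0 , z≤n , nil }) DistLe-zero (u ≟ v)
  distLe? (suc k) u v =
    map′ to from ((u ≟ v) ⊎-dec any? (λ x → (adj G u x Bool.≟ true) ×-dec distLe? k x v))
    where
      to : u ≡ v ⊎ ∃[ x ] (adj G u x ≡ true × DistLe G k x v) → DistLe G (suc k) u v
      to (inj₁ refl)          = 0 , z≤n , nil
      to (inj₂ (x , e , x≤v)) = DistLe-cons e x≤v
      from : DistLe G (suc k) u v → u ≡ v ⊎ ∃[ x ] (adj G u x ≡ true × DistLe G k x v)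
      from (zero  , _       , nil)      = inj₁ refl
      from (suc m , s≤s m≤k , cons e w) = inj₂ (_ , e , m , m≤k , w)

  reachable? : ∀ u v → Dec (Reachable G u v)
  reachable? u v = map′ DistLe⇒Reachable (λ (m , w) → walk⇒DistLe w) (distLe? n u v)

  EccGe-zero : ∀ v → EccGe G v 0
  EccGe-zero v = v , (0 , nil) , λ _ _ → z≤n

  EccGe-suc : ∀ {k v u} → Reachable G v u → ¬ DistLe G k v u → EccGe G v (suc k)
  EccGe-suc {u = u} reach far = u , reach , λ m w → ≰⇒> (λ m≤k → far (m , m≤k , w))

  EccGe-mono : ∀ {j k v} → j ≤ k → EccGe G v k → EccGe G v j
  EccGe-mono j≤k (u , reach , long) = u , reach , λ m w → ≤-trans j≤k (long m w)

  eccGe? : ∀ v k → Dec (EccGe G v k)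
  eccGe? v zero    = yes (EccGe-zero v)
  eccGe? v (suc k) =
    map′ (λ (u , reach , far) → EccGe-suc reach far)
         (λ (u , reach , long) → u , reach , λ { (m , m≤k , w) → <⇒≱ (long m w) m≤k })
         (any? λ u → reachable? v u ×-dec ¬? (distLe? k v u))

  dominated? : ∀ f u → Dec (Dominated G f u)
  dominated? f u = any? λ x → (0 <? f x) ×-dec distLe? (f x) u x

  dominatingBroadcast? : ∀ f → Dec (DominatingBroadcast G f)
  dominatingBroadcast? f = all? (λ v → eccGe? v (f v)) ×-dec all? (dominated? f)

  epbNonempty? : ∀ f v → Dec (EPBNonempty G f v)
  epbNonempty? f v =
    any? λ u → ¬? (u ≟ v) ×-dec (distLe? (f v) u v ×-dec ¬? (dominated? (decAt f v) u))

  dominated-by : ∀ {g u} x {k} → g x ≡ k → 0 < k → DistLe G k u x → Dominated G g u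
  dominated-by x refl gx>0 u≤x = x , gx>0 , u≤x

  DominatingBroadcast-cong : ∀ {f g} → f ≗ g → DominatingBroadcast G f → DominatingBroadcast G g
  DominatingBroadcast-cong f≗g (bc , dom) =
    (λ v → subst (EccGe G v) (f≗g v) (bc v)) ,
    (λ u → let (x , fx>0 , u≤x) = dom u in dominated-by x (sym (f≗g x)) fx>0 u≤x)

  Affordable : ℕ → Set
  Affordable k = ∃[ f ] (DominatingBroadcast G f × cost f ≤ k)

  affordable? : Decidable Affordable
  affordable? k =
    map′ (λ (f , _ , p) → f , p)
         (λ (f , dbf , f≤k) → f , (λ v → ≤-trans (≤-cost f v) f≤k) , dbf , f≤k)
         (∃-bounded? n k
           (λ f≗g (dbf , f≤k) → DominatingBroadcast-cong f≗g dbf , subst (_≤ k) (cost-cong f≗g) f≤k)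
           (λ f → dominatingBroadcast? f ×-dec (cost f ≤? k)))

  γb-broadcast-exists : ∀ {g} → DominatingBroadcast G g → ∃[ f ] IsGammaBBroadcast G f
  γb-broadcast-exists {g} dbg with least affordable? (cost g) (g , dbg , ≤-refl)
  ... | c , (f , dbf , f≤c) , minimal =
    f , dbf , λ h dbh → ≤-trans f≤c (minimal (cost h) (h , dbh , ≤-refl))

  decAt-not-dominating : ∀ {f v} → IsGammaBBroadcast G f → 0 < f v → ¬ IsDominating G (decAt f v)
  decAt-not-dominating {f} {v} ((bc , _) , minimal) fv>0 dom =
    <⇒≱ (cost-update-< f v (pred-< fv>0)) (minimal (decAt f v) (broadcast , dom))
    where
      broadcast : IsBroadcast G (decAt f v)
      broadcast x = EccGe-mono (decAt-≤ f v x) (bc x)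

  private-boundary-nonempty : ∀ {f v} → IsGammaBBroadcast G f → 0 < f v → ∃[ u ] InPB G f v u
  private-boundary-nonempty {f} {v} γf fv>0
    with ¬∀⟶∃¬ n _ (dominated? (decAt f v)) (decAt-not-dominating γf fv>0)
  ... | u , undominated with proj₂ (proj₁ γf) u
  ... | x , fx>0 , u≤x with x ≟ v
  ... | yes refl = u , u≤x , undominated
  ... | no x≢v   = ⊥-elim (undominated (dominated-by x (update-other f _ x≢v) fx>0 u≤x))

  undominated-self⇒≡1 : ∀ {f v} → 0 < f v → ¬ Dominated G (decAt f v) v → f v ≡ 1
  undominated-self⇒≡1 {f} {v} fv>0 undominated = ≤-antisym (≮⇒≥ v-self-dominated) fv>0
    where
      v-self-dominated : ¬ 1 < f v
      v-self-dominated 1<fv =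
        undominated (dominated-by v (update-same f v _) (<⇒≤pred 1<fv) (0 , z≤n , nil))

  empty-EPB⇒dominated : ∀ {f v x} → ¬ EPBNonempty G f v → x ≢ v → DistLe G (f v) x v →
                        Dominated G (decAt f v) x
  empty-EPB⇒dominated {f} {v} {x} no-epb x≢v x≤v =
    decidable-stable (dominated? (decAt f v) x) (λ undominated → no-epb (x , x≢v , x≤v , undominated))

  dominated-by-others : ∀ {f v x} → f v ≡ 1 → Dominated G (decAt f v) x →
                        ∃[ y ] (y ≢ v × 0 < f y × DistLe G (f y) x y)
  dominated-by-others {f} {v} {x} fv≡1 (y , dy>0 , x≤y) =
    y , y≢v , subst (0 <_) dy≡fy dy>0 , subst (λ k → DistLe G k x y) dy≡fy x≤y
    where
      y≢v : y ≢ v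
      y≢v refl = <-irrefl (sym (trans (update-same f v _) (cong pred fv≡1))) dy>0
      dy≡fy : decAt f v y ≡ f y
      dy≡fy = update-other f _ y≢v

  -- |V_f^+|: 1 ⊓ k is 0 for k = 0 and 1 otherwise.
  ∣_∣⁺ : (Fin n → ℕ) → ℕ
  ∣ f ∣⁺ = cost (λ x → 1 ⊓ f x)

  EPBsNonempty : (Fin n → ℕ) → Set
  EPBsNonempty f = ∀ v → 0 < f v → EPBNonempty G f v

  -- Moving v's unit of power to w: the enlarged ball of w contains v, and since
  -- EPB_f(v) = ∅ every other vertex of N_f[v] is dominated without v.
  module Exchange {f : Fin n → ℕ} {v u w : Fin n}
    (dbf : DominatingBroadcast G f) (fv≡1 : f v ≡ 1) (no-epb : ¬ EPBNonempty G f v)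
    (v~u : adj G v u ≡ true) (fw>0 : 0 < f w) (u≤w : DistLe G (f w) u w) (v≰w : ¬ DistLe G (f w) v w)
    where

    w≢v : w ≢ v
    w≢v refl = v≰w (0 , z≤n , nil)

    f′ : Fin n → ℕ
    f′ = update (update f v 0) w (suc (f w))

    f′-w : f′ w ≡ suc (f w)
    f′-w = update-same (update f v 0) w (suc (f w))

    f′-other : ∀ {x} → x ≢ w → x ≢ v → f′ x ≡ f x
    f′-other x≢w x≢v = trans (update-other (update f v 0) _ x≢w) (update-other f _ x≢v)

    v≤w : DistLe G (suc (f w)) v w
    v≤w = DistLe-cons v~u u≤w

    isBroadcast : IsBroadcast G f′
    -- Abstracting over x ≟ w and x ≟ v makes f′ x compute in each branch.
    isBroadcast x with x ≟ w | x ≟ v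
    ... | yes refl | _        = EccGe-suc (DistLe⇒Reachable (DistLe-sym v≤w)) (v≰w ∘ DistLe-sym)
    ... | no _     | yes refl = EccGe-zero v
    ... | no _     | no _     = proj₁ dbf x

    dominated-off-v : ∀ {x y} → y ≢ v → 0 < f y → DistLe G (f y) x y → Dominated G f′ x
    dominated-off-v {y = y} y≢v fy>0 x≤y with y ≟ w
    ... | yes refl = dominated-by w f′-w (s≤s z≤n) (DistLe-weaken (n≤1+n _) x≤y)
    ... | no y≢w   = dominated-by y (f′-other y≢w y≢v) fy>0 x≤y

    isDominating : IsDominating G f′
    isDominating x with proj₂ dbf x
    ... | y , fy>0 , x≤y with y ≟ v
    ... | no y≢v = dominated-off-v y≢v fy>0 x≤y
    ... | yes refl with x ≟ v
    ... | yes refl = dominated-by w f′-w (s≤s z≤n) v≤w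
    ... | no x≢v with dominated-by-others fv≡1 (empty-EPB⇒dominated no-epb x≢v x≤y)
    ... | y′ , y′≢v , fy′>0 , x≤y′ = dominated-off-v y′≢v fy′>0 x≤y′

    cost-f′ : cost f′ ≤ cost f
    cost-f′ = +-cancelʳ-≤ (f w) _ _ (begin
      cost f′ + f w                     ≡⟨ cong (cost f′ +_) (update-other f 0 w≢v) ⟨
      cost f′ + update f v 0 w          ≡⟨ cost-update (update f v 0) w (suc (f w)) ⟩
      cost (update f v 0) + suc (f w)   ≡⟨ +-suc _ (f w) ⟩
      suc (cost (update f v 0)) + f w   ≤⟨ +-monoˡ-≤ (f w) (cost-update-< f v 0<fv) ⟩
      cost f + f w                      ∎)
      where
        open ≤-Reasoning
        0<fv : 0 < f v
        0<fv = subst (0 <_) (sym fv≡1) (s≤s z≤n)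

    fewer-broadcasters : ∣ f′ ∣⁺ < ∣ f ∣⁺
    fewer-broadcasters = begin-strict
      ∣ f′ ∣⁺                            ≡⟨ cost-cong indicator-f′ ⟩
      cost (update (λ x → 1 ⊓ f x) v 0)  <⟨ cost-update-< (λ x → 1 ⊓ f x) v 0<1⊓fv ⟩
      ∣ f ∣⁺                             ∎
      where
        open ≤-Reasoning
        0<1⊓fv : 0 < 1 ⊓ f v
        0<1⊓fv = subst (λ k → 0 < 1 ⊓ k) (sym fv≡1) (s≤s z≤n)
        indicator-f′ : ∀ x → 1 ⊓ f′ x ≡ update (λ y → 1 ⊓ f y) v 0 x
        indicator-f′ x with x ≟ w | x ≟ v
        ... | yes refl | yes w≡v = ⊥-elim (w≢v w≡v)
        ... | yes refl | no _     = sym (1⊓-positive fw>0)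
        ... | no _     | yes refl = refl
        ... | no _     | no _     = refl

  empty-EPB⇒self-undominated : ∀ {f v} → IsGammaBBroadcast G f → 0 < f v → ¬ EPBNonempty G f v →
                               ¬ Dominated G (decAt f v) v
  empty-EPB⇒self-undominated {f} {v} γf fv>0 no-epb with private-boundary-nonempty γf fv>0
  ... | u , u≤v , u-undominated
    with decidable-stable (u ≟ v) (λ u≢v → no-epb (u , u≢v , u≤v , u-undominated))
  ... | refl = u-undominated

  empty-EPB⇒fewer-broadcasters : NoIsolated G → ∀ {f v} → IsGammaBBroadcast G f → 0 < f v →
                                 ¬ EPBNonempty G f v → ∃[ f′ ] (IsGammaBBroadcast G f′ × ∣ f′ ∣⁺ < ∣ f ∣⁺)
  empty-EPB⇒fewer-broadcasters no-isolated {f} {v} γf@(dbf , minimal) fv>0 no-epb =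
    let (u , v~u) = no-isolated v
        u≤v = subst (λ k → DistLe G k u v) (sym fv≡1) (DistLe-sym (DistLe-cons v~u (0 , z≤n , nil)))
        (w , w≢v , fw>0 , u≤w) =
          dominated-by-others fv≡1 (empty-EPB⇒dominated no-epb (adj⇒≢ v~u ∘ sym) u≤v)
        v≰w = λ v≤w → v-undominated (dominated-by w (update-other f _ w≢v) fw>0 v≤w)
        open Exchange dbf fv≡1 no-epb v~u fw>0 u≤w v≰w
    in f′ , ((isBroadcast , isDominating) , λ g dbg → ≤-trans cost-f′ (minimal g dbg)) , fewer-broadcasters
    where
      v-undominated : ¬ Dominated G (decAt f v) v
      v-undominated = empty-EPB⇒self-undominated γf fv>0 no-epb
      fv≡1 : f v ≡ 1
      fv≡1 = undominated-self⇒≡1 fv>0 v-undominated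

  γb-broadcast-with-EPBs : NoIsolated G → ∀ {f} → IsGammaBBroadcast G f →
                           ∃[ g ] (IsGammaBBroadcast G g × EPBsNonempty g)
  γb-broadcast-with-EPBs no-isolated {f} =
    All.wfRec (On.wellFounded ∣_∣⁺ <-wellFounded) _ Goal step f
    where
      Goal : (Fin n → ℕ) → Set
      Goal f = IsGammaBBroadcast G f → ∃[ g ] (IsGammaBBroadcast G g × EPBsNonempty g)
      step : ∀ f → (∀ {f′} → ∣ f′ ∣⁺ < ∣ f ∣⁺ → Goal f′) → Goal f
      step f smaller γf with any? (λ v → (0 <? f v) ×-dec ¬? (epbNonempty? f v))
      ... | yes (v , fv>0 , no-epb) =
        let (f′ , γf′ , fewer) = empty-EPB⇒fewer-broadcasters no-isolated γf fv>0 no-epb in smaller fewer γf′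
      ... | no none = f , γf , λ v fv>0 →
        decidable-stable (epbNonempty? f v) (λ no-epb → none (v , fv>0 , no-epb))

  all-ones-dominating : NoIsolated G → DominatingBroadcast G (λ _ → 1)
  all-ones-dominating no-isolated =
    (λ v → let (u , v~u) = no-isolated v
           in EccGe-suc (1 , cons v~u nil) (adj⇒≢ v~u ∘ DistLe-zero)) ,
    (λ u → u , s≤s z≤n , 0 , z≤n , nil)

proposition1 : ∀ (n : ℕ) (G : Graph n) → NoIsolated G →
    ∃[ f ] (IsGammaBBroadcast G f × (∀ v → 0 < f v → EPBNonempty G f v))
proposition1 n G no-isolated =
  let (f , γf) = γb-broadcast-exists G (all-ones-dominating G no-isolated)
  in γb-broadcast-with-EPBs G no-isolated γf
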